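{- Let $\delta=13\in\mathbb{F}_{19}$ (a primitive element) and let $\alpha\in\mathbb{F}_{19^2}$ be a root of $x^2-\delta$. Let $H=\{1,-1\}$ and $C_{19}^A=\{0\}\cup H\cup 3H\cup 9\alpha H\cup(\alpha+3)H\cup(\alpha-3)H$. Then the setwise stabilizer of $C_{19}^A$ in $\mathrm{Aut}(P(19^2))$ is $\langle\sigma\rangle\times\langle\tau\rangle\cong\mathbb{Z}_2\times\mathbb{Z}_2$, where $\sigma(\gamma)=-\gamma$ and $\tau(\gamma)=\gamma^{19}$ for all $\gamma\in\mathbb{F}_{19^2}$. Moreover, the orbit of $C_{19}^A$ under $\mathrm{Aut}(P(19^2))$ has size $32490$.
   Context: The Paley graph $P(19^2)$ has vertex set $\mathbb{F}_{19^2}$, two distinct vertices adjacent iff their difference is a nonzero square. $\mathrm{Aut}(P(19^2))=\{\gamma\mapsto a\gamma^{v}+b : a \text{ a nonzero square of } \mathbb{F}_{19^2},\ b\in\mathbb{F}_{19^2},\ v\in\mathrm{Gal}(\mathbb{F}_{19^2})\}$, acting on subsets elementwise. Elements of $\mathbb{F}_{19}$ are written as integers mod $19$. -}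

module Defs where

open import Data.Nat using (ℕ; zero; suc) renaming (_+_ to _+ℕ_; _*_ to _*ℕ_)
open import Data.Nat.DivMod using (_mod_)
open import Data.Fin using (Fin; toℕ)
open import Data.Bool using (Bool; true; false; if_then_else_)
open import Data.Product using (Σ; ∃; _×_; _,_)
open import Data.Vec using (Vec; lookup)
open import Data.List using (List; []; _∷_)
open import Data.List.Membership.Propositional using (_∈_)
open import Relation.Binary.PropositionalEquality using (_≡_; _≢_)
open import Relation.Nullary using (¬_)

F19 : Set
F19 = Fin 19

[_]₁₉ : ℕ → F19
[ n ]₁₉ = n mod 19

_⊕_ : F19 → F19 → F19
a ⊕ b = [ toℕ a +ℕ toℕ b ]₁₉

_⊗_ : F19 → F19 → F19
a ⊗ b = [ toℕ a *ℕ toℕ b ]₁₉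

⊖_ : F19 → F19
⊖ a = [ 18 *ℕ toℕ a ]₁₉

-- δ = 13, a primitive element of F_19 (in particular a non-square)
δ : F19
δ = [ 13 ]₁₉

-- F_{19^2} = F_19[α]/(α² - δ); the pair (a , b) stands for a + bα.

F : Set
F = F19 × F19

embed : F19 → F
embed a = (a , [ 0 ]₁₉)

𝟘 𝟙 α : F
𝟘 = embed [ 0 ]₁₉
𝟙 = embed [ 1 ]₁₉
α = ([ 0 ]₁₉ , [ 1 ]₁₉)

infixl 6 _+_
infixl 7 _*_

_+_ : F → F → F
(a , b) + (c , d) = (a ⊕ c , b ⊕ d)

-- (a + bα)(c + dα) = (ac + δbd) + (ad + bc)α   since α² = δ
_*_ : F → F → F
(a , b) * (c , d) = ((a ⊗ c) ⊕ (δ ⊗ (b ⊗ d)) , (a ⊗ d) ⊕ (b ⊗ c))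

-_ : F → F
- (a , b) = (⊖ a , ⊖ b)

_^_ : F → ℕ → F
x ^ zero = 𝟙
x ^ suc n = x * (x ^ n)

-- Automorphisms of the Paley graph P(19²):  γ ↦ a γ^v + b,
-- a a nonzero square, b ∈ F, v ∈ Gal(F_{19²}/F_19) = {id, Frobenius}.

IsNonzeroSquare : F → Set
IsNonzeroSquare a = a ≢ 𝟘 × ∃ λ c → a ≡ c * c

galois : Bool → F → F
galois false γ = γ
galois true  γ = γ ^ 19

record Aut : Set where
  constructor aut
  field
    mult  : F
    isSq  : IsNonzeroSquare mult
    shift : F
    frob  : Bool

apply : Aut → F → F
apply (aut a _ b v) γ = a * galois v γ + b

Subset : Set₁
Subset = F → Set

image : Aut → Subset → Subset
image g S y = ∃ λ x → S x × apply g x ≡ y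

_≐_ : Subset → Subset → Set
S ≐ T = ∀ y → (S y → T y) × (T y → S y)

H : F → List F
H x = x ∷ - x ∷ []

three nine : F
three = embed [ 3 ]₁₉
nine  = embed [ 9 ]₁₉

CA-list : List F
CA-list = 𝟘 ∷ (H 𝟙 Data.List.++ H three Data.List.++ H (nine * α)
              Data.List.++ H (α + three) Data.List.++ H (α + (- three)))

CA : Subset
CA x = x ∈ CA-list

σ τ : F → F
σ γ = - γ
τ γ = γ ^ 19

Stabilizes : Aut → Subset → Set
Stabilizes g S = image g S ≐ S

ActsAs : Aut → (F → F) → Set
ActsAs g f = ∀ γ → apply g γ ≡ f γ

OrbitSize : Subset → ℕ → Set
OrbitSize S n = Σ (Vec Aut n) λ gs →
    (∀ i j → i ≢ j → ¬ (image (lookup gs i) S ≐ image (lookup gs j) S))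
  × (∀ h → ∃ λ i → image h S ≐ image (lookup gs i) S)

{-# OPTIONS --safe #-}

-- An automorphism γ ↦ a γ^v + b that maps C^A into itself sends 0 and 1 into C^A, so both b and
-- a + b lie in the 13-element set C^A. Running through these 13 · 13 · 2 candidates shows that
-- b = 0 and a = ±1, so the stabilizer consists of the four maps γ ↦ ±γ^v, all of which preserve
-- C^A because C^A is closed under negation and under the Frobenius map a + bα ↦ a − bα.
-- Since γ ↦ a γ^v + b differs from γ ↦ (±a) γ + b by one of these maps, the orbit is in bijection
-- with the maps γ ↦ r γ + b, where b ∈ F_{19²} and r runs over the 180 nonzero squares modulo sign:
-- 90 · 361 = 32490 of them.

module Submission where

open import Algebra.Bundles using (CommutativeRing)
open import Algebra.Core using (Op₁; Op₂)
open import Algebra.Structures using (IsCommutativeRing)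
open import Data.Bool using (Bool; true; false)
open import Data.Fin using (Fin; _≟_)
open import Data.Fin.Properties using (all?; any?; *↔×)
open import Data.List.Relation.Unary.All as All using (All)
open import Data.List.Relation.Unary.Any using (here; there)
open import Data.Nat using (ℕ)
open import Data.Product using (_×_; _,_; ∃; ∃₂; proj₁; proj₂; uncurry; curry)
open import Data.Product.Function.NonDependent.Propositional using (_×-↔_)
open import Data.Product.Properties using (≡-dec)
open import Data.Sign using (Sign)
open import Data.Sum using (_⊎_; inj₁; inj₂; [_,_]′)
open import Data.Vec as Vec using (Vec; []; _∷_)
open import Data.Vec.Properties using (lookup∘tabulate)
open import Function using (id; _∘_; _⇔_; mk⇔; _↔_; Inverse; Equivalence)
open import Function.Construct.Composition using (_⇔-∘_)
open import Function.Properties.Inverse using (↔-refl; ↔-trans)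
open import Level using (0ℓ)
open import Relation.Binary.Definitions using (DecidableEquality)
open import Relation.Binary.PropositionalEquality
open import Relation.Nullary using (¬_)
open import Relation.Nullary.Decidable using (Dec; from-yes; ¬?; _→-dec_; _×-dec_; _⊎-dec_; map′; dec⇒maybe)
open import Relation.Unary using (Pred; Decidable)
open import Tactic.RingSolver using (solve-∀)
open import Tactic.RingSolver.Core.AlmostCommutativeRing using (AlmostCommutativeRing; fromCommutativeRing)

open import Defs

-- F₁₉ and F₁₉[α] as commutative rings

module _ {A : Set} {_+ᴬ_ _*ᴬ_ : Op₂ A} { -ᴬ_ : Op₁ A} {0ᴬ 1ᴬ : A} where

  open import Algebra.Definitions {A = A} _≡_
  open import Algebra.Consequences.Propositional {A = A}

  isCommutativeRingˡ : Associative _+ᴬ_ → Commutative _+ᴬ_ → LeftIdentity 0ᴬ _+ᴬ_ → LeftInverse 0ᴬ -ᴬ_ _+ᴬ_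
                     → Associative _*ᴬ_ → Commutative _*ᴬ_ → LeftIdentity 1ᴬ _*ᴬ_ → _*ᴬ_ DistributesOverˡ _+ᴬ_
                     → IsCommutativeRing _≡_ _+ᴬ_ _*ᴬ_ -ᴬ_ 0ᴬ 1ᴬ
  isCommutativeRingˡ +-assoc +-comm +-identityˡ -‿inverseˡ *-assoc *-comm *-identityˡ distribˡ = record
    { isRing = record
      { +-isAbelianGroup = record
        { isGroup = record
          { isMonoid = record
            { isSemigroup = record
              { isMagma = record { isEquivalence = isEquivalence ; ∙-cong = cong₂ _+ᴬ_ }
              ; assoc = +-assoc }
            ; identity = comm∧idˡ⇒id +-comm +-identityˡ }
          ; inverse = comm∧invˡ⇒inv +-comm -‿inverseˡ
          ; ⁻¹-cong = cong -ᴬ_ }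
        ; comm = +-comm }
      ; *-cong = cong₂ _*ᴬ_
      ; *-assoc = *-assoc
      ; *-identity = comm∧idˡ⇒id *-comm *-identityˡ
      ; distrib = distribˡ , comm∧distrˡ⇒distrʳ *-comm distribˡ }
    ; *-comm = *-comm }

-- Facts decided by evaluation are kept opaque: unfolding them would make the type checker
-- re-run the decision procedure wherever they occur in a type.
opaque
  ⊕-assoc : ∀ a b c → (a ⊕ b) ⊕ c ≡ a ⊕ (b ⊕ c)
  ⊕-assoc = from-yes (all? λ a → all? λ b → all? λ c → (a ⊕ b) ⊕ c ≟ a ⊕ (b ⊕ c))

  ⊕-comm : ∀ a b → a ⊕ b ≡ b ⊕ a
  ⊕-comm = from-yes (all? λ a → all? λ b → a ⊕ b ≟ b ⊕ a)

  ⊕-identityˡ : ∀ a → [ 0 ]₁₉ ⊕ a ≡ a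
  ⊕-identityˡ = from-yes (all? λ a → [ 0 ]₁₉ ⊕ a ≟ a)

  ⊖-inverseˡ : ∀ a → (⊖ a) ⊕ a ≡ [ 0 ]₁₉
  ⊖-inverseˡ = from-yes (all? λ a → (⊖ a) ⊕ a ≟ [ 0 ]₁₉)

  ⊗-assoc : ∀ a b c → (a ⊗ b) ⊗ c ≡ a ⊗ (b ⊗ c)
  ⊗-assoc = from-yes (all? λ a → all? λ b → all? λ c → (a ⊗ b) ⊗ c ≟ a ⊗ (b ⊗ c))

  ⊗-comm : ∀ a b → a ⊗ b ≡ b ⊗ a
  ⊗-comm = from-yes (all? λ a → all? λ b → a ⊗ b ≟ b ⊗ a)

  ⊗-identityˡ : ∀ a → [ 1 ]₁₉ ⊗ a ≡ a
  ⊗-identityˡ = from-yes (all? λ a → [ 1 ]₁₉ ⊗ a ≟ a)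

  ⊗-distribˡ-⊕ : ∀ a b c → a ⊗ (b ⊕ c) ≡ (a ⊗ b) ⊕ (a ⊗ c)
  ⊗-distribˡ-⊕ = from-yes (all? λ a → all? λ b → all? λ c → a ⊗ (b ⊕ c) ≟ (a ⊗ b) ⊕ (a ⊗ c))

F19-isCommutativeRing : IsCommutativeRing _≡_ _⊕_ _⊗_ ⊖_ [ 0 ]₁₉ [ 1 ]₁₉
F19-isCommutativeRing =
  isCommutativeRingˡ ⊕-assoc ⊕-comm ⊕-identityˡ ⊖-inverseˡ ⊗-assoc ⊗-comm ⊗-identityˡ ⊗-distribˡ-⊕

F19-ring : AlmostCommutativeRing 0ℓ 0ℓ
F19-ring = fromCommutativeRing (record { isCommutativeRing = F19-isCommutativeRing }) (λ a → dec⇒maybe ([ 0 ]₁₉ ≟ a))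

open import Tactic.RingSolver.NonReflective F19-ring
  using (solve; Κ) renaming (_⊜_ to infix 4 _⊜_; _⊕_ to infixl 6 _:+_; _⊗_ to infixl 7 _:*_)

+-assoc : ∀ x y z → (x + y) + z ≡ x + (y + z)
+-assoc (a , b) (c , d) (e , f) = cong₂ _,_ (⊕-assoc a c e) (⊕-assoc b d f)

+-comm : ∀ x y → x + y ≡ y + x
+-comm (a , b) (c , d) = cong₂ _,_ (⊕-comm a c) (⊕-comm b d)

+-identityˡ : ∀ x → 𝟘 + x ≡ x
+-identityˡ (a , b) = cong₂ _,_ (⊕-identityˡ a) (⊕-identityˡ b)

-‿inverseˡ : ∀ x → (- x) + x ≡ 𝟘
-‿inverseˡ (a , b) = cong₂ _,_ (⊖-inverseˡ a) (⊖-inverseˡ b)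

*-assoc : ∀ x y z → (x * y) * z ≡ x * (y * z)
*-assoc (a , b) (c , d) (e , f) = cong₂ _,_
  (solve 7 (λ a b c d e f δ → (a :* c :+ δ :* (b :* d)) :* e :+ δ :* ((a :* d :+ b :* c) :* f)
                             ⊜ a :* (c :* e :+ δ :* (d :* f)) :+ δ :* (b :* (c :* f :+ d :* e))) refl a b c d e f δ)
  (solve 7 (λ a b c d e f δ → (a :* c :+ δ :* (b :* d)) :* f :+ (a :* d :+ b :* c) :* e
                             ⊜ a :* (c :* f :+ d :* e) :+ b :* (c :* e :+ δ :* (d :* f))) refl a b c d e f δ)

*-comm : ∀ x y → x * y ≡ y * x
*-comm (a , b) (c , d) = cong₂ _,_
  (solve 5 (λ a b c d δ → a :* c :+ δ :* (b :* d) ⊜ c :* a :+ δ :* (d :* b)) refl a b c d δ)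
  (solve 4 (λ a b c d → a :* d :+ b :* c ⊜ c :* b :+ d :* a) refl a b c d)

*-identityˡ : ∀ x → 𝟙 * x ≡ x
*-identityˡ (a , b) = cong₂ _,_
  (solve 3 (λ a b δ → Κ [ 1 ]₁₉ :* a :+ δ :* (Κ [ 0 ]₁₉ :* b) ⊜ a) refl a b δ)
  (solve 2 (λ a b → Κ [ 1 ]₁₉ :* b :+ Κ [ 0 ]₁₉ :* a ⊜ b) refl a b)

*-distribˡ-+ : ∀ x y z → x * (y + z) ≡ (x * y) + (x * z)
*-distribˡ-+ (a , b) (c , d) (e , f) = cong₂ _,_
  (solve 7 (λ a b c d e f δ → a :* (c :+ e) :+ δ :* (b :* (d :+ f))
                             ⊜ (a :* c :+ δ :* (b :* d)) :+ (a :* e :+ δ :* (b :* f))) refl a b c d e f δ)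
  (solve 6 (λ a b c d e f → a :* (d :+ f) :+ b :* (c :+ e)
                           ⊜ (a :* d :+ b :* c) :+ (a :* f :+ b :* e)) refl a b c d e f)

F-isCommutativeRing : IsCommutativeRing _≡_ _+_ _*_ -_ 𝟘 𝟙
F-isCommutativeRing =
  isCommutativeRingˡ +-assoc +-comm +-identityˡ -‿inverseˡ *-assoc *-comm *-identityˡ *-distribˡ-+

F-commutativeRing : CommutativeRing 0ℓ 0ℓ
F-commutativeRing = record { isCommutativeRing = F-isCommutativeRing }

infix 4 _≟F_

_≟F_ : DecidableEquality F
_≟F_ = ≡-dec _≟_ _≟_

open import Data.List.Membership.DecPropositional _≟F_ using (_∈?_)

F-ring : AlmostCommutativeRing 0ℓ 0ℓ
F-ring = fromCommutativeRing F-commutativeRing (λ x → dec⇒maybe (𝟘 ≟F x))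

open CommutativeRing F-commutativeRing using (+-identityʳ; *-identityʳ; zeroˡ)
open import Algebra.Properties.Ring (CommutativeRing.ring F-commutativeRing)
  using (-‿involutive; -‿distribˡ-*; -‿distribʳ-*; x∙y⁻¹≈ε⇒x≈y)

all-F? : ∀ {P : Pred F 0ℓ} → Decidable P → Dec (∀ x → P x)
all-F? P? = map′ uncurry curry (all? λ a → all? λ b → P? (a , b))

signed : Sign → F → F
signed Sign.+ x = x
signed Sign.- x = - x

infix 4 _≡±_ _≟±_

_≡±_ : F → F → Set
x ≡± y = ∃ λ s → x ≡ signed s y

_≟±_ : ∀ x y → Dec (x ≡± y)
x ≟± y = map′ [ (Sign.+ ,_) , (Sign.- ,_) ]′ sign-cases (x ≟F y ⊎-dec x ≟F - y)
  where
  sign-cases : x ≡± y → x ≡ y ⊎ x ≡ - y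
  sign-cases (Sign.+ , x≡y) = inj₁ x≡y
  sign-cases (Sign.- , x≡-y) = inj₂ x≡-y

signed-involutive : ∀ s x → signed s (signed s x) ≡ x
signed-involutive Sign.+ x = refl
signed-involutive Sign.- x = -‿involutive x

signed-*ˡ : ∀ s x y → signed s x * y ≡ signed s (x * y)
signed-*ˡ Sign.+ x y = refl
signed-*ˡ Sign.- x y = sym (-‿distribˡ-* x y)

signed-*ʳ : ∀ s x y → x * signed s y ≡ signed s (x * y)
signed-*ʳ Sign.+ x y = refl
signed-*ʳ Sign.- x y = sym (-‿distribʳ-* x y)

signed-𝟙-* : ∀ s y → signed s 𝟙 * y ≡ signed s y
signed-𝟙-* s y = trans (signed-*ˡ s 𝟙 y) (cong (signed s) (*-identityˡ y))

signed-𝟙-affine : ∀ s y → signed s 𝟙 * y + 𝟘 ≡ signed s y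
signed-𝟙-affine s y = trans (+-identityʳ _) (signed-𝟙-* s y)

conj : F → F
conj (a , b) = (a , ⊖ b)

norm : F → F19
norm (a , b) = (a ⊗ a) ⊕ (δ ⊗ ((⊖ b) ⊗ b))

opaque
  conj-involutive : ∀ x → conj (conj x) ≡ x
  conj-involutive = from-yes (all-F? λ x → conj (conj x) ≟F x)

  conj-*-self : ∀ x → conj x * x ≡ embed (norm x)
  conj-*-self = from-yes (all-F? λ x → conj x * x ≟F embed (norm x))

  embed-* : ∀ m n → embed m * embed n ≡ embed (m ⊗ n)
  embed-* = from-yes (all? λ m → all? λ n → embed m * embed n ≟F embed (m ⊗ n))

  ⊗-inverse : ∀ n → n ≢ [ 0 ]₁₉ → ∃ λ m → m ⊗ n ≡ [ 1 ]₁₉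
  ⊗-inverse = from-yes (all? λ n → ¬? (n ≟ [ 0 ]₁₉) →-dec any? λ m → m ⊗ n ≟ [ 1 ]₁₉)

  norm-nonzero : ∀ x → x ≢ 𝟘 → norm x ≢ [ 0 ]₁₉
  norm-nonzero = from-yes (all-F? λ x → ¬? (x ≟F 𝟘) →-dec ¬? (norm x ≟ [ 0 ]₁₉))

*-inverse : ∀ x → x ≢ 𝟘 → ∃ λ y → y * x ≡ 𝟙
*-inverse x x≢𝟘 = embed m * conj x , (begin
    (embed m * conj x) * x     ≡⟨ *-assoc (embed m) (conj x) x ⟩
    embed m * (conj x * x)     ≡⟨ cong (embed m *_) (conj-*-self x) ⟩
    embed m * embed (norm x)   ≡⟨ embed-* m (norm x) ⟩
    embed (m ⊗ norm x)         ≡⟨ cong embed m⊗norm≡1 ⟩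
    𝟙                          ∎)
  where
  open ≡-Reasoning
  m : F19
  m = proj₁ (⊗-inverse (norm x) (norm-nonzero x x≢𝟘))
  m⊗norm≡1 : m ⊗ norm x ≡ [ 1 ]₁₉
  m⊗norm≡1 = proj₂ (⊗-inverse (norm x) (norm-nonzero x x≢𝟘))

inverse⇒cancel : ∀ w r → w * r ≡ 𝟙 → ∀ x → (w * x) * r ≡ x
inverse⇒cancel w r w*r≡𝟙 x = begin
  (w * x) * r   ≡⟨ rearrange w x r ⟩
  x * (w * r)   ≡⟨ cong (x *_) w*r≡𝟙 ⟩
  x * 𝟙         ≡⟨ *-identityʳ x ⟩
  x             ∎
  where
  open ≡-Reasoning
  rearrange : ∀ w x r → (w * x) * r ≡ x * (w * r)
  rearrange = solve-∀ F-ring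

opaque
  frobenius-conj : ∀ γ → γ ^ 19 ≡ conj γ
  frobenius-conj = from-yes (all-F? λ γ → γ ^ 19 ≟F conj γ)

galois-involutive : ∀ v γ → galois v (galois v γ) ≡ γ
galois-involutive false γ = refl
galois-involutive true γ = begin
  (γ ^ 19) ^ 19   ≡⟨ frobenius-conj (γ ^ 19) ⟩
  conj (γ ^ 19)   ≡⟨ cong conj (frobenius-conj γ) ⟩
  conj (conj γ)   ≡⟨ conj-involutive γ ⟩
  γ               ∎
  where open ≡-Reasoning

galois-signed : ∀ v s γ → galois v (signed s γ) ≡ signed s (galois v γ)
galois-signed false s γ = refl
galois-signed true Sign.+ γ = refl
galois-signed true Sign.- γ = begin
  (- γ) ^ 19     ≡⟨ frobenius-conj (- γ) ⟩
  conj (- γ)     ≡⟨⟩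
  - conj γ       ≡⟨ cong -_ (frobenius-conj γ) ⟨
  - (γ ^ 19)     ∎
  where open ≡-Reasoning

galois-𝟘 : ∀ v → galois v 𝟘 ≡ 𝟘
galois-𝟘 false = refl
galois-𝟘 true = refl

galois-𝟙 : ∀ v → galois v 𝟙 ≡ 𝟙
galois-𝟙 false = refl
galois-𝟙 true = refl

signedGalois : Sign → Bool → F → F
signedGalois s v γ = signed s (galois v γ)

signedGalois-involutive : ∀ s v γ → signedGalois s v (signedGalois s v γ) ≡ γ
signedGalois-involutive s v γ = begin
  signed s (galois v (signed s (galois v γ)))   ≡⟨ cong (signed s) (galois-signed v s (galois v γ)) ⟩
  signed s (signed s (galois v (galois v γ)))   ≡⟨ signed-involutive s (galois v (galois v γ)) ⟩
  galois v (galois v γ)                         ≡⟨ galois-involutive v γ ⟩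
  γ                                             ∎
  where open ≡-Reasoning

signed-𝟙-isNonzeroSquare : ∀ s → IsNonzeroSquare (signed s 𝟙)
signed-𝟙-isNonzeroSquare Sign.+ = (λ ()) , 𝟙 , refl
signed-𝟙-isNonzeroSquare Sign.- = (λ ()) , ([ 0 ]₁₉ , [ 4 ]₁₉) , refl   -- (4α)² = 16 · 13 = −1

signedGaloisAut : Sign → Bool → Aut
signedGaloisAut s v = aut (signed s 𝟙) (signed-𝟙-isNonzeroSquare s) 𝟘 v

signedGaloisAut-actsAs : ∀ s v → ActsAs (signedGaloisAut s v) (signedGalois s v)
signedGaloisAut-actsAs s v γ = signed-𝟙-affine s (galois v γ)

signedGalois-cases : ∀ {g} → (∃₂ λ s v → ActsAs g (signedGalois s v))
                   ⇔ (ActsAs g (λ γ → γ) ⊎ ActsAs g σ ⊎ ActsAs g τ ⊎ ActsAs g (λ γ → σ (τ γ)))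
signedGalois-cases {g} = mk⇔ to from
  where
  to : (∃₂ λ s v → ActsAs g (signedGalois s v))
     → ActsAs g (λ γ → γ) ⊎ ActsAs g σ ⊎ ActsAs g τ ⊎ ActsAs g (λ γ → σ (τ γ))
  to (Sign.+ , false , g≗f) = inj₁ g≗f
  to (Sign.- , false , g≗f) = inj₂ (inj₁ g≗f)
  to (Sign.+ , true , g≗f) = inj₂ (inj₂ (inj₁ g≗f))
  to (Sign.- , true , g≗f) = inj₂ (inj₂ (inj₂ g≗f))
  from : ActsAs g (λ γ → γ) ⊎ ActsAs g σ ⊎ ActsAs g τ ⊎ ActsAs g (λ γ → σ (τ γ))
       → ∃₂ λ s v → ActsAs g (signedGalois s v)
  from (inj₁ g≗f) = Sign.+ , false , g≗f
  from (inj₂ (inj₁ g≗f)) = Sign.- , false , g≗f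
  from (inj₂ (inj₂ (inj₁ g≗f))) = Sign.+ , true , g≗f
  from (inj₂ (inj₂ (inj₂ g≗f))) = Sign.- , true , g≗f

stabilizes⇒preserves : ∀ {g S x} → Stabilizes g S → S x → S (apply g x)
stabilizes⇒preserves {x = x} g[S]≐S Sx = proj₁ (g[S]≐S _) (x , Sx , refl)

actsAs-involution⇒stabilizes : ∀ {g S} {f : F → F} → ActsAs g f → (∀ {x} → S x → S (f x))
                             → (∀ x → f (f x) ≡ x) → Stabilizes g S
actsAs-involution⇒stabilizes {g} {S} {f} g≗f f-preserves f-involutive y = into , onto
  where
  into : image g S y → S y
  into (x , Sx , gx≡y) = subst S (trans (sym (g≗f x)) gx≡y) (f-preserves Sx)
  onto : S y → image g S y
  onto Sy = f y , f-preserves Sy , trans (g≗f (f y)) (f-involutive y)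

image-≐-precompose : ∀ {g h S} {f : F → F} → (∀ {x} → S x → S (f x)) → (∀ x → f (f x) ≡ x)
                   → (∀ x → apply h x ≡ apply g (f x)) → image h S ≐ image g S
image-≐-precompose {g} {h} {S} {f} f-preserves f-involutive h≗g∘f y = into , onto
  where
  into : image h S y → image g S y
  into (x , Sx , hx≡y) = f x , f-preserves Sx , trans (sym (h≗g∘f x)) hx≡y
  onto : image g S y → image h S y
  onto (x , Sx , gx≡y) = f x , f-preserves Sx , trans (h≗g∘f (f x)) (trans (cong (apply g) (f-involutive x)) gx≡y)

image-⊆⇒preserves : ∀ {g h S} (h⁻¹ : F → F) → (∀ y → h⁻¹ (apply h y) ≡ y)
                  → (∀ y → image g S y → image h S y) → ∀ {x} → S x → S (h⁻¹ (apply g x))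
image-⊆⇒preserves {g} {h} {S} h⁻¹ h⁻¹∘h≗id g[S]⊆h[S] {x} Sx with g[S]⊆h[S] (apply g x) (x , Sx , refl)
... | y , Sy , hy≡gx = subst S (trans (sym (h⁻¹∘h≗id y)) (cong h⁻¹ hy≡gx)) Sy

orbitSize-from-transversal : ∀ {n} {P : Set} {S} (index : Fin n ↔ P) (representative : P → Aut)
                           → (∀ p p′ → image (representative p) S ≐ image (representative p′) S → p ≡ p′)
                           → (∀ h → ∃ λ p → image h S ≐ image (representative p) S)
                           → OrbitSize S n
orbitSize-from-transversal {n} {P} {S} index representative injective covering = gs , distinct , covered
  where
  open Inverse index using (to; from; strictlyInverseˡ; strictlyInverseʳ)
  gs : Vec Aut n
  gs = Vec.tabulate (representative ∘ to)
  lookup-gs : ∀ i → Vec.lookup gs i ≡ representative (to i)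
  lookup-gs = lookup∘tabulate (representative ∘ to)
  distinct : ∀ i j → i ≢ j → ¬ (image (Vec.lookup gs i) S ≐ image (Vec.lookup gs j) S)
  distinct i j i≢j images≐ = i≢j (begin
    i             ≡⟨ strictlyInverseʳ i ⟨
    from (to i)   ≡⟨ cong from (injective (to i) (to j) images≐′) ⟩
    from (to j)   ≡⟨ strictlyInverseʳ j ⟩
    j             ∎)
    where
    open ≡-Reasoning
    images≐′ = subst₂ (λ g g′ → image g S ≐ image g′ S) (lookup-gs i) (lookup-gs j) images≐
  covered : ∀ h → ∃ λ i → image h S ≐ image (Vec.lookup gs i) S
  covered h = from-representative (covering h)
    where
    from-representative : (∃ λ p → image h S ≐ image (representative p) S) → ∃ λ i → image h S ≐ image (Vec.lookup gs i) S
    from-representative (p , h≐p) = from p , subst (λ g → image h S ≐ image g S)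
      (sym (trans (lookup-gs (from p)) (cong representative (strictlyInverseˡ p)))) h≐p

-- The stabilizer of C^A

MapsCAIntoCA : F → F → Bool → Set
MapsCAIntoCA a b v = All (λ x → CA (a * galois v x + b)) CA-list

-- b and c are the images of 0 and 1, so the map is x ↦ (c − b) x^v + b.
StabilizerTable : Bool → Set
StabilizerTable v =
  All (λ b → All (λ c → c + - b ≢ 𝟘 → MapsCAIntoCA (c + - b) b v → b ≡ 𝟘 × c + - b ≡± 𝟙) CA-list) CA-list

stabilizerTable? : ∀ v → Dec (StabilizerTable v)
stabilizerTable? v = All.all? (λ b → All.all? (λ c → let a = c + - b in
    ¬? (a ≟F 𝟘) →-dec All.all? (λ x → a * galois v x + b ∈? CA-list) CA-list →-dec b ≟F 𝟘 ×-dec a ≟± 𝟙)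
  CA-list) CA-list

opaque
  stabilizerTable : ∀ v → StabilizerTable v
  stabilizerTable false = from-yes (stabilizerTable? false)
  stabilizerTable true = from-yes (stabilizerTable? true)

  CA-closed-under-negation : ∀ {γ} → CA γ → CA (- γ)
  CA-closed-under-negation = All.lookup (from-yes (All.all? (λ γ → - γ ∈? CA-list) CA-list))

  CA-closed-under-frobenius : ∀ {γ} → CA γ → CA (γ ^ 19)
  CA-closed-under-frobenius = All.lookup (from-yes (All.all? (λ γ → γ ^ 19 ∈? CA-list) CA-list))

signedGalois-preserves-CA : ∀ s v {γ} → CA γ → CA (signedGalois s v γ)
signedGalois-preserves-CA Sign.+ false = id
signedGalois-preserves-CA Sign.+ true = CA-closed-under-frobenius
signedGalois-preserves-CA Sign.- false = CA-closed-under-negation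
signedGalois-preserves-CA Sign.- true = CA-closed-under-negation ∘ CA-closed-under-frobenius

CA-preserving⇒signedGalois : ∀ {a b} v → a ≢ 𝟘 → (∀ {x} → CA x → CA (a * galois v x + b)) → b ≡ 𝟘 × a ≡± 𝟙
CA-preserving⇒signedGalois {a} {b} v a≢𝟘 preserves =
  subst (λ a → a ≢ 𝟘 → MapsCAIntoCA a b v → b ≡ 𝟘 × a ≡± 𝟙) (sym (recover a b))
        (All.lookup (All.lookup (stabilizerTable v) b∈CA) c∈CA) a≢𝟘 (All.tabulate preserves)
  where
  a*𝟘+b≡b : ∀ a b → a * 𝟘 + b ≡ b
  a*𝟘+b≡b = solve-∀ F-ring
  recover : ∀ a b → a ≡ (a * 𝟙 + b) + - b
  recover = solve-∀ F-ring
  b∈CA : CA b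
  b∈CA = subst CA (trans (cong (λ t → a * t + b) (galois-𝟘 v)) (a*𝟘+b≡b a b)) (preserves (here refl))
  c∈CA : CA (a * 𝟙 + b)
  c∈CA = subst CA (cong (λ t → a * t + b) (galois-𝟙 v)) (preserves (there (here refl)))

stabilizer-CA : ∀ g → Stabilizes g CA ⇔ (∃₂ λ s v → ActsAs g (signedGalois s v))
stabilizer-CA g@(aut a (a≢𝟘 , _) b v) = mk⇔ signedGalois-of stabilizes
  where
  signedGalois-of : Stabilizes g CA → ∃₂ λ s v → ActsAs g (signedGalois s v)
  signedGalois-of g[CA]≐CA = actsAs (CA-preserving⇒signedGalois v a≢𝟘 (stabilizes⇒preserves {g} {CA} g[CA]≐CA))
    where
    actsAs : b ≡ 𝟘 × a ≡± 𝟙 → ∃₂ λ s v → ActsAs g (signedGalois s v)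
    actsAs (b≡𝟘 , s , a≡±𝟙) =
      s , v , λ γ → trans (cong₂ (λ a b → a * galois v γ + b) a≡±𝟙 b≡𝟘) (signed-𝟙-affine s (galois v γ))
  stabilizes : (∃₂ λ s v → ActsAs g (signedGalois s v)) → Stabilizes g CA
  stabilizes (s , v , g≗f) =
    actsAs-involution⇒stabilizes {g} {CA} g≗f (signedGalois-preserves-CA s v) (signedGalois-involutive s v)

-- The orbit of C^A

affine-image-⊆⇒preserves-CA : ∀ {r r′ b b′} w (r-sq : IsNonzeroSquare r) (r′-sq : IsNonzeroSquare r′) → w * r′ ≡ 𝟙
                            → (∀ y → image (aut r r-sq b false) CA y → image (aut r′ r′-sq b′ false) CA y)
                            → ∀ {x} → CA x → CA ((w * r) * galois false x + w * (b + - b′))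
affine-image-⊆⇒preserves-CA {r} {r′} {b} {b′} w r-sq r′-sq w*r′≡𝟙 image⊆image {x} CAx =
  subst CA (undo-affine w r x b b′)
        (image-⊆⇒preserves {aut r r-sq b false} {aut r′ r′-sq b′ false} {CA} undo undo-apply image⊆image CAx)
  where
  undo : F → F
  undo z = w * (z + - b′)
  undo-shift : ∀ w r y b → w * ((r * y + b) + - b) ≡ (w * y) * r
  undo-shift = solve-∀ F-ring
  undo-apply : ∀ y → undo (r′ * y + b′) ≡ y
  undo-apply y = trans (undo-shift w r′ y b′) (inverse⇒cancel w r′ w*r′≡𝟙 y)
  undo-affine : ∀ w r x b b′ → w * ((r * x + b) + - b′) ≡ (w * r) * x + w * (b + - b′)
  undo-affine = solve-∀ F-ring

affine-images-of-CA-≐ : ∀ {r r′ b b′} (r-sq : IsNonzeroSquare r) (r′-sq : IsNonzeroSquare r′)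
                      → image (aut r r-sq b false) CA ≐ image (aut r′ r′-sq b′ false) CA → b ≡ b′ × r ≡± r′
affine-images-of-CA-≐ {r} {r′} {b} {b′} r-sq@(r≢𝟘 , _) r′-sq@(r′≢𝟘 , _) images≐ =
  from-inverse (*-inverse r′ r′≢𝟘)
  where
  from-inverse : (∃ λ w → w * r′ ≡ 𝟙) → b ≡ b′ × r ≡± r′
  from-inverse (w , w*r′≡𝟙) =
    from-shift-and-sign (CA-preserving⇒signedGalois {w * r} {w * (b + - b′)} false w*r≢𝟘 CA-preserved)
    where
    unscale : ∀ {x y} → w * x ≡ y → x ≡ y * r′
    unscale {x} w*x≡y = trans (sym (inverse⇒cancel w r′ w*r′≡𝟙 x)) (cong (_* r′) w*x≡y)
    CA-preserved : ∀ {x} → CA x → CA ((w * r) * galois false x + w * (b + - b′))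
    CA-preserved = affine-image-⊆⇒preserves-CA w r-sq r′-sq w*r′≡𝟙 (λ y → proj₁ (images≐ y))
    w*r≢𝟘 : w * r ≢ 𝟘
    w*r≢𝟘 w*r≡𝟘 = r≢𝟘 (trans (unscale w*r≡𝟘) (zeroˡ r′))
    from-shift-and-sign : w * (b + - b′) ≡ 𝟘 × w * r ≡± 𝟙 → b ≡ b′ × r ≡± r′
    from-shift-and-sign (w*[b-b′]≡𝟘 , s , w*r≡±𝟙) =
      x∙y⁻¹≈ε⇒x≈y b b′ (trans (unscale w*[b-b′]≡𝟘) (zeroˡ r′)) , s , trans (unscale w*r≡±𝟙) (signed-𝟙-* s r′)

-- c ↦ c² identifies the nonzero elements up to the fourth roots of unity ±1, ±4α with the nonzero
-- squares up to sign; the pair (m , n) stands for c = m + nα, one from each of the 90 classes.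
rootCoordinates : Vec (ℕ × ℕ) 90
rootCoordinates =
  (0 , 1) ∷ (0 , 2) ∷ (0 , 3) ∷ (0 , 4) ∷ (0 , 5) ∷ (0 , 6) ∷ (0 , 7) ∷ (0 , 8) ∷ (0 , 9) ∷ (1 , 1) ∷
  (1 , 2) ∷ (1 , 3) ∷ (1 , 4) ∷ (1 , 5) ∷ (1 , 6) ∷ (1 , 7) ∷ (1 , 8) ∷ (1 , 9) ∷ (1 , 10) ∷ (1 , 11) ∷
  (1 , 12) ∷ (1 , 13) ∷ (1 , 14) ∷ (1 , 16) ∷ (1 , 17) ∷ (1 , 18) ∷ (2 , 1) ∷ (2 , 2) ∷ (2 , 3) ∷ (2 , 5) ∷
  (2 , 6) ∷ (2 , 7) ∷ (2 , 8) ∷ (2 , 9) ∷ (2 , 10) ∷ (2 , 12) ∷ (2 , 13) ∷ (2 , 14) ∷ (2 , 16) ∷ (2 , 17) ∷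
  (2 , 18) ∷ (3 , 1) ∷ (3 , 2) ∷ (3 , 3) ∷ (3 , 5) ∷ (3 , 6) ∷ (3 , 7) ∷ (3 , 9) ∷ (3 , 10) ∷ (3 , 13) ∷
  (3 , 14) ∷ (3 , 16) ∷ (3 , 17) ∷ (3 , 18) ∷ (4 , 1) ∷ (4 , 2) ∷ (4 , 3) ∷ (4 , 5) ∷ (4 , 6) ∷ (4 , 9) ∷
  (4 , 10) ∷ (4 , 13) ∷ (4 , 14) ∷ (4 , 17) ∷ (4 , 18) ∷ (5 , 1) ∷ (5 , 2) ∷ (5 , 5) ∷ (5 , 6) ∷ (5 , 9) ∷
  (5 , 10) ∷ (5 , 13) ∷ (5 , 14) ∷ (5 , 17) ∷ (6 , 2) ∷ (6 , 5) ∷ (6 , 6) ∷ (6 , 9) ∷ (6 , 10) ∷ (6 , 13) ∷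
  (6 , 17) ∷ (7 , 2) ∷ (7 , 6) ∷ (7 , 9) ∷ (7 , 13) ∷ (7 , 17) ∷ (8 , 2) ∷ (8 , 6) ∷ (8 , 17) ∷ (9 , 2) ∷ []

root : Fin 90 → F
root q = let m , n = Vec.lookup rootCoordinates q in [ m ]₁₉ , [ n ]₁₉

representative : Fin 90 → F
representative q = root q * root q

opaque
  representative-nonzero : ∀ q → representative q ≢ 𝟘
  representative-nonzero = from-yes (all? λ q → ¬? (representative q ≟F 𝟘))

  square-≡±-representative : ∀ c → c ≢ 𝟘 → ∃ λ q → c * c ≡± representative q
  square-≡±-representative = from-yes (all-F? λ c → ¬? (c ≟F 𝟘) →-dec any? λ q → c * c ≟± representative q)

  representative-≡±-injective : ∀ q q′ → representative q ≡± representative q′ → q ≡ q′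
  representative-≡±-injective = from-yes (all? λ q → all? λ q′ → representative q ≟± representative q′ →-dec q ≟ q′)

representative-isNonzeroSquare : ∀ q → IsNonzeroSquare (representative q)
representative-isNonzeroSquare q = representative-nonzero q , root q , refl

orbitRepresentative : Fin 90 × F → Aut
orbitRepresentative (q , b) = aut (representative q) (representative-isNonzeroSquare q) b false

orbitRepresentative-injective : ∀ p p′ → image (orbitRepresentative p) CA ≐ image (orbitRepresentative p′) CA → p ≡ p′
orbitRepresentative-injective (q , b) (q′ , b′) images≐ =
  same-class (affine-images-of-CA-≐ (representative-isNonzeroSquare q) (representative-isNonzeroSquare q′) images≐)
  where
  same-class : b ≡ b′ × representative q ≡± representative q′ → (q , b) ≡ (q′ , b′)
  same-class (b≡b′ , rq≡±rq′) = cong₂ _,_ (representative-≡±-injective q q′ rq≡±rq′) b≡b′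

image-CA-≐-orbitRepresentative : ∀ h → ∃ λ p → image h CA ≐ image (orbitRepresentative p) CA
image-CA-≐-orbitRepresentative h@(aut a (a≢𝟘 , c , a≡c*c) b v) = from-class (square-≡±-representative c c≢𝟘)
  where
  c≢𝟘 : c ≢ 𝟘
  c≢𝟘 c≡𝟘 = a≢𝟘 (trans a≡c*c (cong (λ c → c * c) c≡𝟘))
  from-class : (∃ λ q → c * c ≡± representative q) → ∃ λ p → image h CA ≐ image (orbitRepresentative p) CA
  from-class (q , s , c*c≡±r) = (q , b) , image-≐-precompose {orbitRepresentative (q , b)} {h} {CA}
    (signedGalois-preserves-CA s v) (signedGalois-involutive s v) (λ x → cong (_+ b) (h≗r∘f x))
    where
    open ≡-Reasoning
    r = representative q
    h≗r∘f : ∀ x → a * galois v x ≡ r * signedGalois s v x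
    h≗r∘f x = begin
      a * galois v x              ≡⟨ cong (_* galois v x) (trans a≡c*c c*c≡±r) ⟩
      signed s r * galois v x     ≡⟨ signed-*ˡ s r (galois v x) ⟩
      signed s (r * galois v x)   ≡⟨ signed-*ʳ s r (galois v x) ⟨
      r * signed s (galois v x)   ∎

orbitIndex : Fin 32490 ↔ (Fin 90 × F)
orbitIndex = ↔-trans *↔× (↔-refl ×-↔ *↔×)

lemma3p23 :
    -- σ and τ are automorphisms of P(19²) (realised by some element of Aut)
    (∃ λ g → ActsAs g σ) × (∃ λ g → ActsAs g τ)
    -- ⟨σ⟩ × ⟨τ⟩ ≅ Z₂ × Z₂ : σ, τ involutions, commuting, σ ≠ id, τ ≠ id, σ ≠ τ
    × (∀ γ → σ (σ γ) ≡ γ) × (∀ γ → τ (τ γ) ≡ γ) × (∀ γ → σ (τ γ) ≡ τ (σ γ))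
    × (∃ λ γ → σ γ ≢ γ) × (∃ λ γ → τ γ ≢ γ) × (∃ λ γ → σ γ ≢ τ γ)
    -- the setwise stabilizer of C^A_19 is exactly {id, σ, τ, στ}
    × (∀ g → (Stabilizes g CA
               → ActsAs g (λ γ → γ) ⊎ ActsAs g σ ⊎ ActsAs g τ ⊎ ActsAs g (λ γ → σ (τ γ)))
             × (ActsAs g (λ γ → γ) ⊎ ActsAs g σ ⊎ ActsAs g τ ⊎ ActsAs g (λ γ → σ (τ γ))
               → Stabilizes g CA))
    -- the orbit of C^A_19 under Aut(P(19²)) has size 32490
    × OrbitSize CA 32490
lemma3p23 =
    (signedGaloisAut Sign.- false , signedGaloisAut-actsAs Sign.- false)
  , (signedGaloisAut Sign.+ true , signedGaloisAut-actsAs Sign.+ true)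
  , signedGalois-involutive Sign.- false
  , signedGalois-involutive Sign.+ true
  , (λ γ → sym (galois-signed true Sign.- γ))
  , (𝟙 , λ ()) , (α , λ ()) , (𝟙 , λ ())
  , (λ g → Equivalence.to (stabilizer g) , Equivalence.from (stabilizer g))
  , orbitSize-from-transversal orbitIndex orbitRepresentative orbitRepresentative-injective image-CA-≐-orbitRepresentative
  where
  stabilizer : ∀ g → Stabilizes g CA ⇔ (ActsAs g (λ γ → γ) ⊎ ActsAs g σ ⊎ ActsAs g τ ⊎ ActsAs g (λ γ → σ (τ γ)))
  stabilizer g = signedGalois-cases {g} ⇔-∘ stabilizer-CA g
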